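{- For every integer $n$, $$L_{n-1}^2-F_{n-4}F_n-F_nF_{n+1}=F_{n-2}^2,$$ where $F_k$ and $L_k$ denote the $k$-th Fibonacci and Lucas numbers.
   Context: The Fibonacci numbers are $F_0=0$, $F_1=1$, $F_{k+1}=F_k+F_{k-1}$, and the Lucas numbers are $L_0=2$, $L_1=1$, $L_{k+1}=L_k+L_{k-1}$; both are extended to negative indices by the same recurrence, so that $F_{ -m}=(-1)^{m+1}F_m$ and $L_{ -m}=(-1)^mL_m$. -}

module Defs where

open import Data.Nat using (ℕ; zero; suc)
open import Data.Integer using (ℤ; +_; -[1+_]; _+_; -_)

fibℕ : ℕ → ℤ
fibℕ zero = + 0
fibℕ (suc zero) = + 1
fibℕ (suc (suc k)) = fibℕ (suc k) + fibℕ k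

lucℕ : ℕ → ℤ
lucℕ zero = + 2
lucℕ (suc zero) = + 1
lucℕ (suc (suc k)) = lucℕ (suc k) + lucℕ k

signPow : ℕ → ℤ → ℤ
signPow zero x = x
signPow (suc m) x = - signPow m x

-- Extension to negative indices: F_{-m} = (-1)^{m+1} F_m, L_{-m} = (-1)^m L_m
-- (the unique extension satisfying the same recurrence).
F : ℤ → ℤ
F (+ n) = fibℕ n
F -[1+ m ] = signPow (suc (suc m)) (fibℕ (suc m))

L : ℤ → ℤ
L (+ n) = lucℕ n
L -[1+ m ] = signPow (suc m) (lucℕ (suc m))

{-# OPTIONS --safe #-}
module Submission where

open import Defs
open import Data.Nat using (ℕ; zero; suc) renaming (_+_ to _+ℕ_)
import Data.Nat.Properties as ℕ
open import Data.Integer using (ℤ; +_; -[1+_]; _+_; _-_; _*_; -_)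
open import Data.Integer.Properties using (*-identityˡ; neg-distribˡ-*; +-assoc)
open import Data.Integer.Tactic.RingSolver using (solve-∀)
open import Relation.Binary.PropositionalEquality
  using (_≡_; refl; sym; trans; cong; cong₂; subst; module ≡-Reasoning)
open ≡-Reasoning

-- The Fibonacci recurrence, and L (k + 1) = F k + F (k + 2), hold at every integer index. Shifting
-- by n - 4, the identity becomes one about an arbitrary sequence G with G (i + 2) = G (i + 1) + G i,
-- which reduces to a polynomial identity in G 0 and G 1.

signPow≡signPow1* : ∀ m x → signPow m x ≡ signPow m (+ 1) * x
signPow≡signPow1* zero    x = sym (*-identityˡ x)
signPow≡signPow1* (suc m) x = trans (cong -_ (signPow≡signPow1* m x)) (neg-distribˡ-* (signPow m (+ 1)) x)

lucℕ-suc≡fibℕ+fibℕ : ∀ j → lucℕ (suc j) ≡ fibℕ j + fibℕ (suc (suc j))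
lucℕ-suc≡fibℕ+fibℕ zero          = refl
lucℕ-suc≡fibℕ+fibℕ (suc zero)    = refl
lucℕ-suc≡fibℕ+fibℕ (suc (suc j)) =
  trans (cong₂ _+_ (lucℕ-suc≡fibℕ+fibℕ (suc j)) (lucℕ-suc≡fibℕ+fibℕ j)) (regroup (fibℕ j) (fibℕ (suc j)))
  where
  regroup : ∀ a b → (b + ((b + a) + b)) + (a + (b + a)) ≡ (b + a) + (((b + a) + b) + (b + a))
  regroup = solve-∀

F-rec : ∀ k → F (k + + 2) ≡ F (k + + 1) + F k
F-rec (+ n) rewrite ℕ.+-comm n 2 | ℕ.+-comm n 1 = refl
F-rec -[1+ 0 ] = refl
F-rec -[1+ 1 ] = refl
F-rec -[1+ suc (suc j) ] = begin
  signPow s₂ b                                   ≡⟨ signPow≡signPow1* s₂ b ⟩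
  signPow s₂ (+ 1) * b                           ≡⟨ alternating (signPow j (+ 1)) b c ⟩
  signPow s₃ (+ 1) * c + signPow s₄ (+ 1) * (c + b)
    ≡⟨ sym (cong₂ _+_ (signPow≡signPow1* s₃ c) (signPow≡signPow1* s₄ (c + b))) ⟩
  signPow s₃ c + signPow s₄ (c + b)              ∎
  where
  s₂ s₃ s₄ : ℕ
  s₂ = suc (suc j)
  s₃ = suc s₂
  s₄ = suc s₃
  b c : ℤ
  b = fibℕ (suc j)
  c = fibℕ (suc (suc j))
  alternating : ∀ e b c → - - e * b ≡ - - - e * c + - - - - e * (c + b)
  alternating = solve-∀

L≡F+F : ∀ k → L (k + + 1) ≡ F k + F (k + + 2)
L≡F+F (+ n) rewrite ℕ.+-comm n 2 | ℕ.+-comm n 1 = lucℕ-suc≡fibℕ+fibℕ n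
L≡F+F -[1+ 0 ] = refl
L≡F+F -[1+ 1 ] = refl
L≡F+F -[1+ suc (suc j) ] = begin
  signPow s₂ (lucℕ (suc (suc j)))                ≡⟨ cong (signPow s₂) (lucℕ-suc≡fibℕ+fibℕ (suc j)) ⟩
  signPow s₂ (b + d)                             ≡⟨ signPow≡signPow1* s₂ (b + d) ⟩
  signPow s₂ (+ 1) * (b + d)                     ≡⟨ alternating (signPow j (+ 1)) b d ⟩
  signPow s₄ (+ 1) * d + signPow s₂ (+ 1) * b
    ≡⟨ sym (cong₂ _+_ (signPow≡signPow1* s₄ d) (signPow≡signPow1* s₂ b)) ⟩
  signPow s₄ d + signPow s₂ b                    ∎
  where
  s₂ s₄ : ℕ
  s₂ = suc (suc j)
  s₄ = suc (suc s₂)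
  b d : ℤ
  b = fibℕ (suc j)
  d = fibℕ (suc (suc (suc j)))
  alternating : ∀ e b d → - - e * (b + d) ≡ - - - - e * d + - - e * b
  alternating = solve-∀

gibonacci-identity : (G : ℕ → ℤ) → (∀ i → G (suc (suc i)) ≡ G (suc i) + G i) →
  (G 2 + G 4) * (G 2 + G 4) - G 0 * G 4 - G 4 * G 5 ≡ G 2 * G 2
gibonacci-identity G rec rewrite rec 3 | rec 2 | rec 1 | rec 0 = polynomial (G 0) (G 1)
  where
  polynomial : ∀ a b →
    ((b + a) + (((b + a) + b) + (b + a))) * ((b + a) + (((b + a) + b) + (b + a)))
      - a * (((b + a) + b) + (b + a))
      - (((b + a) + b) + (b + a)) * ((((b + a) + b) + (b + a)) + ((b + a) + b))
      ≡ (b + a) * (b + a)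
  polynomial = solve-∀

F-shifted-rec : ∀ m i → F (m + + suc (suc i)) ≡ F (m + + suc i) + F (m + + i)
F-shifted-rec m i = begin
  F (m + + (2 +ℕ i))                ≡⟨ cong F (reassoc 2) ⟨
  F (m + + i + + 2)                 ≡⟨ F-rec (m + + i) ⟩
  F (m + + i + + 1) + F (m + + i)   ≡⟨ cong (λ k → F k + F (m + + i)) (reassoc 1) ⟩
  F (m + + (1 +ℕ i)) + F (m + + i)  ∎
  where
  reassoc : ∀ k → m + + i + + k ≡ m + + (k +ℕ i)
  reassoc k = trans (+-assoc m (+ i) (+ k)) (cong (λ j → m + + j) (ℕ.+-comm i k))

proposition2p2-shifted : ∀ m →
    L (m + + 4 - + 1) * L (m + + 4 - + 1) - F (m + + 4 - + 4) * F (m + + 4) - F (m + + 4) * F (m + + 4 + + 1)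
    ≡ F (m + + 4 - + 2) * F (m + + 4 - + 2)
-- Each index m + + 4 ± k reassociates to m + + j, the Lucas number becoming F (m + + 2) + F (m + + 4).
proposition2p2-shifted m
  rewrite +-assoc m (+ 4) (- + 1) | +-assoc m (+ 4) (- + 2) | +-assoc m (+ 4) (- + 4) | +-assoc m (+ 4) (+ 1)
        | sym (+-assoc m (+ 2) (+ 1)) | L≡F+F (m + + 2) | +-assoc m (+ 2) (+ 2)
  = gibonacci-identity (λ i → F (m + + i)) (F-shifted-rec m)

proposition2p2 : (n : ℤ) →
    L (n - + 1) * L (n - + 1) - F (n - + 4) * F n - F n * F (n + + 1)
      ≡ F (n - + 2) * F (n - + 2)
proposition2p2 n = subst P (n-4+4≡n n) (proposition2p2-shifted (n - + 4))
  where
  P : ℤ → Set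
  P k = L (k - + 1) * L (k - + 1) - F (k - + 4) * F k - F k * F (k + + 1) ≡ F (k - + 2) * F (k - + 2)
  n-4+4≡n : ∀ k → k - + 4 + + 4 ≡ k
  n-4+4≡n = solve-∀
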